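{- Let $q$ be a power of an odd prime, let $\lambda\in\mathbb{F}_q$ be a non-square, and let $f=Xw(X^2)+a\in\mathbb{F}_q[X]$ with $w\in\mathbb{F}_q[X]$ and $a\in\mathbb{F}_q^*$ be a permutation polynomial of $\mathbb{F}_q$. Then: (i) every directed path of Type 1 in $\mathcal{G}(\lambda,f)$ contains at most $\lfloor\frac{3}{4}q+\frac{17}{4}\rfloor$ vertices; (ii) if moreover $q>17$ and $\mathcal{G}(\lambda,f)$ is connected, then $\mathcal{G}(\lambda,f)$ has no Hamiltonian cycle of Type 1.
   Context: For a polynomial $f\in\mathbb{F}_q[X]$ and a non-square $\lambda\in\mathbb{F}_q$, $\mathcal{G}(\lambda,f)$ is the directed graph with vertex set $\mathbb{F}_q$ and an edge from $x$ to $y$ iff $(y^2-f(x))(\lambda y^2-f(x))=0$ (loops allowed); connected means weakly connected; paths have distinct vertices. Weights: an edge $(x,y)$ has weight $0$ if $y^2=f(x)$ and weight $1$ otherwise (so the edge into vertex $0$ has weight $0$). A trail is a directed path all of whose edges have the same weight; its length is its number of edges. A directed path is of Type $n$ if it contains a trail of length $n$ but no trail of length greater than $n$. A Hamiltonian cycle $H$ of a connected component is of Type $n$ if $H\setminus\{0\}$ (the cycle with vertex $0$ and its incident edges removed) is a path of Type $n$. -}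

module Defs where

open import Data.Nat using (ℕ; zero; suc; _<_)
open import Data.Fin using (Fin)
open import Data.Fin.Properties using (_≟_)
open import Data.Bool using (Bool)
open import Data.List using (List; []; _∷_; _++_; length; [_])
open import Data.List.Relation.Unary.All using (All)
open import Data.List.Relation.Unary.Unique.Propositional using (Unique)
open import Data.List.Membership.Propositional using (_∈_)
open import Data.Product using (Σ; ∃; _×_; _,_)
open import Data.Sum using (_⊎_)
open import Relation.Nullary using (¬_; does)
open import Relation.Binary.PropositionalEquality using (_≡_; _≢_)
open import Relation.Binary.Construct.Closure.ReflexiveTransitive using (Star)
open import Algebra.Core using (Op₁; Op₂)
open import Algebra.Structures using (IsCommutativeRing)

-- A finite field with q elements, realised on the carrier Fin q
-- (every finite field of order q is isomorphic to one of these).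
record FiniteField (q : ℕ) : Set where
  field
    _+_ _*_ : Op₂ (Fin q)
    -_      : Op₁ (Fin q)
    0# 1#   : Fin q
    isCommutativeRing : IsCommutativeRing _≡_ _+_ _*_ -_ 0# 1#
    0≢1     : 0# ≢ 1#
    inverse : ∀ x → x ≢ 0# → ∃ λ y → x * y ≡ 1#
  infixl 6 _+_
  infixl 7 _*_

module _ {q : ℕ} (F : FiniteField q) where
  open FiniteField F

  _-_ : Op₂ (Fin q)
  x - y = x + (- y)

  IsSquare : Fin q → Set
  IsSquare x = ∃ λ y → y * y ≡ x

  -- evaluation of a polynomial given by its coefficient list
  -- c₀ ∷ c₁ ∷ … (ascending degree), by Horner's rule
  evalPoly : List (Fin q) → Fin q → Fin q
  evalPoly []       x = 0#
  evalPoly (c ∷ cs) x = c + x * evalPoly cs x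

  fPoly : List (Fin q) → Fin q → Fin q → Fin q
  fPoly w a x = x * evalPoly w (x * x) + a

  IsPermutation : (Fin q → Fin q) → Set
  IsPermutation f = (∀ {x y} → f x ≡ f y → x ≡ y) × (∀ y → ∃ λ x → f x ≡ y)

  consecutive : {A : Set} → List A → List (A × A)
  consecutive (x ∷ y ∷ xs) = (x , y) ∷ consecutive (y ∷ xs)
  consecutive _            = []

  module Graph (λ' : Fin q) (f : Fin q → Fin q) where

    Edge : Fin q → Fin q → Set
    Edge x y = ((y * y) - f x) * ((λ' * (y * y)) - f x) ≡ 0#

    EdgeP : Fin q × Fin q → Set
    EdgeP (x , y) = Edge x y

    -- weight of an edge: true = weight 0 (y² = f x), false = weight 1
    weight : Fin q → Fin q → Bool
    weight x y = does (y * y ≟ f x)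

    WeightIs : Bool → Fin q × Fin q → Set
    WeightIs b (x , y) = weight x y ≡ b

    IsPath : List (Fin q) → Set
    IsPath vs = Unique vs × All EdgeP (consecutive vs)

    -- the path vs contains a trail of length n (n edges, all of equal weight)
    ContainsTrail : ℕ → List (Fin q) → Set
    ContainsTrail n vs =
      Σ (List (Fin q)) λ xs → Σ (List (Fin q)) λ ys → Σ (List (Fin q)) λ zs →
        (vs ≡ xs ++ (ys ++ zs)) × (length ys ≡ suc n) ×
        (Σ Bool λ b → All (WeightIs b) (consecutive ys))

    IsTypePath : ℕ → List (Fin q) → Set
    IsTypePath n vs = IsPath vs × ContainsTrail n vs ×
                      (∀ m → n < m → ¬ ContainsTrail m vs)

    Connected : Set
    Connected = ∀ x y → Star (λ u v → Edge u v ⊎ Edge v u) x y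

    -- Hamiltonian cycle 0 → r₁ → … → r_{q-1} → 0, written starting at vertex 0
    -- and given by the list rest = r₁ … r_{q-1}
    IsHamCycle : List (Fin q) → Set
    IsHamCycle rest = Unique (0# ∷ rest) × (∀ x → x ∈ (0# ∷ rest)) ×
                      All EdgeP (consecutive ((0# ∷ rest) ++ [ 0# ]))

    IsTypeHamCycle : ℕ → List (Fin q) → Set
    IsTypeHamCycle n rest = IsHamCycle rest × IsTypePath n rest

module Submission where

-- Write c = 2a, so that f(x) + f(-x) = c. Along a path of Type 1 the edge weights alternate, and the
-- edge leaving x has weight 0 exactly when f(x) is a square. If x ≠ -x are both interior vertices,
-- their incoming edges have different weights (equal weights would give them a common predecessor,
-- as f is injective and x² = (-x)²), so exactly one of f(x), f(-x) is a square; the nonsquare t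
-- among them has c - t a square. So, apart from the at most two pairs {x, -x} containing an end of
-- the path, every pair met twice by the path gives a splitting c = t + (c - t) with t a nonsquare and
-- c - t a square, and there are at most 1 + (q - 1)/4 of these. As the path meets at most (q + 1)/2
-- pairs, its number n of vertices satisfies 4n ≤ 3q + 13, too few for a Hamiltonian cycle if q > 17.

open import Defs
open import Level using (0ℓ)
open import Data.Bool using (Bool; true; false; not)
open import Data.Bool.Properties using (¬-not)
open import Data.Nat using (ℕ; zero; suc; _≤_; _^_; _/_; z≤n; s≤s) renaming (_+_ to _+ℕ_; _*_ to _*ℕ_)
import Data.Nat.Properties as ℕ
open import Data.Nat.DivMod using (m*n/n≡m; /-monoˡ-≤)
open import Data.Nat.Divisibility using (_∣_; ∣1⇒≡1; m∣m*n)
open import Data.Nat.Primality using (Prime; euclidsLemma; prime⇒irreducible; prime[2]; ¬prime[1])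
open import Data.Nat.Tactic.RingSolver using (solve-∀)
open import Data.Fin using (Fin)
open import Data.Fin.Properties using (_≟_; any?; _<?_; <-cmp; <-asym; <-irrefl)
open import Data.List using (List; []; _∷_; _++_; length; head; last; filter; map; allFin)
open import Data.List.Properties using (filter-all; filter-none; filter-≐; length-map; length-tabulate)
open import Data.List.Relation.Unary.All using (All; []; _∷_)
import Data.List.Relation.Unary.All as All
open import Data.List.Relation.Unary.Any using (here; there)
open import Data.List.Relation.Unary.AllPairs using ([]; _∷_)
open import Data.List.Relation.Unary.Unique.Propositional using (Unique)
import Data.List.Relation.Unary.Unique.Propositional.Properties as Unique
open import Data.List.Membership.Propositional using (_∈_)
open import Data.List.Membership.Propositional.Properties using (∈-filter⁺; ∈-filter⁻; ∈-allFin; ∈-map⁻)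
open import Data.Maybe using (Maybe; just)
import Data.Maybe.Properties as Maybe
open import Data.Product using (∃; _×_; _,_; proj₁; proj₂)
import Data.Product as Product
open import Data.Sum using (_⊎_; inj₁; inj₂)
open import Data.Unit using (tt)
open import Data.Empty using (⊥; ⊥-elim)
open import Relation.Nullary using (¬_; yes; no; ¬?)
open import Relation.Nullary.Decidable using (_×-dec_)
open import Relation.Unary using (Pred; Decidable; _⊆_; _∩_; _∪_; ∁)
open import Relation.Unary.Properties using (U?; _∩?_; _∪?_; ∁?)
open import Relation.Binary.Definitions using (DecidableEquality; tri<; tri≈; tri>)
open import Relation.Binary.PropositionalEquality
open import Algebra.Bundles using (CommutativeRing)

module _ {A : Set} where

  unique-map⁺ : {P : Pred A 0ℓ} (g : A → A) → (∀ {x y} → P x → P y → g x ≡ g y → x ≡ y) →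
                ∀ {xs} → All P xs → Unique xs → Unique (map g xs)
  unique-map⁺ g inj [] [] = []
  unique-map⁺ g inj (px ∷ pxs) (x∉xs ∷ u) = apart pxs x∉xs ∷ unique-map⁺ g inj pxs u
    where
    apart : ∀ {ys} → All _ ys → All (_ ≢_) ys → All (g _ ≢_) (map g ys)
    apart []           []           = []
    apart (py ∷ pys) (x≢y ∷ x∉ys) = (λ gx≡gy → x≢y (inj px py gx≡gy)) ∷ apart pys x∉ys

  module _ (_≟ᴬ_ : DecidableEquality A) where

    private
      remove : A → List A → List A
      remove z = filter (λ y → ¬? (y ≟ᴬ z))

      length≤1+remove : ∀ z ys → Unique ys → length ys ≤ suc (length (remove z ys))
      length≤1+remove z []       _           = z≤n
      length≤1+remove z (y ∷ ys) (y∉ys ∷ u) with y ≟ᴬ z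
      ... | yes refl = s≤s (ℕ.≤-reflexive (sym (cong length
                         (filter-all (λ w → ¬? (w ≟ᴬ y)) (All.map (λ y≢w w≡y → y≢w (sym w≡y)) y∉ys)))))
      ... | no  _    = s≤s (length≤1+remove z ys u)

    unique-⊆⇒length≤ : ∀ {xs} ys → Unique xs → (∀ {x} → x ∈ xs → x ∈ ys) → length xs ≤ length ys
    unique-⊆⇒length≤ {[]}    ys       _ _  = z≤n
    unique-⊆⇒length≤ {_ ∷ _} []       _ xs⊆ with () ← xs⊆ (here refl)
    unique-⊆⇒length≤ {xs}    (y ∷ ys) u xs⊆ =
      ℕ.≤-trans (length≤1+remove y xs u)
              (s≤s (unique-⊆⇒length≤ ys (Unique.filter⁺ _ u) remove⊆))
      where
      remove⊆ : ∀ {x} → x ∈ remove y xs → x ∈ ys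
      remove⊆ x∈ with ∈-filter⁻ (λ w → ¬? (w ≟ᴬ y)) x∈
      ... | x∈xs , x≢y with xs⊆ x∈xs
      ...   | here x≡y = ⊥-elim (x≢y x≡y)
      ...   | there x∈ys = x∈ys

module _ {A : Set} {P Q : Pred A 0ℓ} (P? : Decidable P) (Q? : Decidable Q) where

  open import Data.Nat using (_+_)

  length-filter-split : ∀ xs → length (filter P? xs) ≡
                        length (filter (P? ∩? Q?) xs) + length (filter (P? ∩? ∁? Q?) xs)
  length-filter-split []       = refl
  length-filter-split (x ∷ xs) with P? x | Q? x
  ... | yes _ | yes _ = cong suc (length-filter-split xs)
  ... | yes _ | no  _ = trans (cong suc (length-filter-split xs)) (sym (ℕ.+-suc _ _))
  ... | no  _ | yes _ = length-filter-split xs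
  ... | no  _ | no  _ = length-filter-split xs

module Counting (n : ℕ) where

  open import Data.Nat using (_+_)
  open import Data.Fin using (_<_)

  count : {P : Pred (Fin n) 0ℓ} → Decidable P → ℕ
  count P? = length (filter P? (allFin n))

  n≤length : (vs : List (Fin n)) → (∀ x → x ∈ vs) → n ≤ length vs
  n≤length vs covers = ℕ.≤-trans (ℕ.≤-reflexive (sym (length-tabulate (λ x → x))))
    (unique-⊆⇒length≤ _≟_ vs (Unique.allFin⁺ n) (λ {x} _ → covers x))

  module _ {P : Pred (Fin n) 0ℓ} (P? : Decidable P) where

    length≤count : ∀ vs → Unique vs → (∀ {x} → x ∈ vs → P x) → length vs ≤ count P?
    length≤count vs u vs⊆P = unique-⊆⇒length≤ _≟_ _ u (λ {x} x∈ → ∈-filter⁺ P? (∈-allFin x) (vs⊆P x∈))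

    ∈-count : ∀ {x} → x ∈ filter P? (allFin n) → P x
    ∈-count x∈ = proj₂ (∈-filter⁻ P? {xs = allFin n} x∈)

    unique-count : Unique (filter P? (allFin n))
    unique-count = Unique.filter⁺ P? (Unique.allFin⁺ n)

    1≤count : ∀ {z} → P z → 1 ≤ count P?
    1≤count {z} pz = length≤count (z ∷ []) ([] ∷ []) λ { (here refl) → pz }

    count-none : (∀ x → ¬ P x) → count P? ≡ 0
    count-none none = cong length (filter-none P? {xs = allFin n} (All.tabulate λ {x} _ → none x))

    count≤1 : (∀ {x y} → P x → P y → x ≡ y) → count P? ≤ 1
    count≤1 sub = go _ unique-count ∈-count
      where
      go : ∀ xs → Unique xs → (∀ {x} → x ∈ xs → P x) → length xs ≤ 1
      go []           _                _  = z≤n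
      go (_ ∷ [])     _                _  = s≤s z≤n
      go (_ ∷ _ ∷ _) ((x≢y ∷ _) ∷ _) xs⊆P = ⊥-elim (x≢y (sub (xs⊆P (here refl)) (xs⊆P (there (here refl)))))

  module _ {P Q : Pred (Fin n) 0ℓ} (P? : Decidable P) (Q? : Decidable Q) where

    count-injection : (g : Fin n → Fin n) → (∀ {x} → P x → Q (g x)) →
                      (∀ {x y} → P x → P y → g x ≡ g y → x ≡ y) → count P? ≤ count Q?
    count-injection g P⇒Q inj = ℕ.≤-trans (ℕ.≤-reflexive (sym (length-map g (filter P? (allFin n)))))
      (length≤count Q? _ (unique-map⁺ g inj (All.tabulate {xs = filter P? (allFin n)} (∈-count P?)) (unique-count P?)) image⊆Q)
      where
      image⊆Q : ∀ {y} → y ∈ map g (filter P? (allFin n)) → Q y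
      image⊆Q y∈ with ∈-map⁻ g y∈
      ... | _ , x∈ , refl = P⇒Q (∈-count P? x∈)

    count-mono : P ⊆ Q → count P? ≤ count Q?
    count-mono P⊆Q = count-injection (λ x → x) P⊆Q (λ _ _ x≡y → x≡y)

    count-ext : P ⊆ Q → Q ⊆ P → count P? ≡ count Q?
    count-ext P⊆Q Q⊆P = cong length (filter-≐ P? Q? (P⊆Q , Q⊆P) (allFin n))

    count-split : count P? ≡ count (P? ∩? Q?) + count (P? ∩? ∁? Q?)
    count-split = length-filter-split P? Q? (allFin n)

  module _ {P Q : Pred (Fin n) 0ℓ} (P? : Decidable P) (Q? : Decidable Q) where

    count-∪ : count (P? ∪? Q?) ≤ count P? + count Q?
    count-∪ = ℕ.≤-trans (ℕ.≤-reflexive (count-split (P? ∪? Q?) P?))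
      (ℕ.+-mono-≤ (count-mono _ P? proj₂) (count-mono _ Q? λ { (inj₁ p , ¬p) → ⊥-elim (¬p p) ; (inj₂ q , _) → q }))

    count-surjection : (g : Fin n → Fin n) → (∀ {y} → Q y → ∃ λ x → P x × g x ≡ y) → count Q? ≤ count P?
    count-surjection g onto = count-injection Q? P? section (λ qy → proj₁ (section-spec qy)) inj
      where
      section : Fin n → Fin n
      section y with any? (P? ∩? (λ x → g x ≟ y))
      ... | yes (x , _) = x
      ... | no  _       = y
      section-spec : ∀ {y} → Q y → P (section y) × g (section y) ≡ y
      section-spec {y} qy with any? (P? ∩? (λ x → g x ≟ y))
      ... | yes (_ , spec) = spec
      ... | no  none       = ⊥-elim (none (onto qy))
      inj : ∀ {y y'} → Q y → Q y' → section y ≡ section y' → y ≡ y'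
      inj qy qy' e = trans (sym (proj₂ (section-spec qy))) (trans (cong g e) (proj₂ (section-spec qy')))

    count-disjoint : {R : Pred (Fin n) 0ℓ} (R? : Decidable R) → P ⊆ R → Q ⊆ R →
                     (∀ {x} → P x → Q x → ⊥) → count P? + count Q? ≤ count R?
    count-disjoint R? P⊆R Q⊆R disjoint = ℕ.≤-trans
      (ℕ.+-mono-≤ (count-mono P? (R? ∩? P?) λ p → P⊆R p , p)
                (count-mono Q? (R? ∩? ∁? P?) λ q → Q⊆R q , λ p → disjoint p q))
      (ℕ.≤-reflexive (sym (count-split R? P?)))

  count-complement : {P : Pred (Fin n) 0ℓ} (P? : Decidable P) → count P? + count (∁? P?) ≡ n
  count-complement P? = begin
    count P? + count (∁? P?)                 ≡⟨ cong₂ _+_ (count-ext P? (U? ∩? P?) (λ p → tt , p) proj₂)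
                                                         (count-ext (∁? P?) (U? ∩? ∁? P?) (λ p → tt , p) proj₂) ⟩
    count (U? ∩? P?) + count (U? ∩? ∁? P?)  ≡⟨ sym (count-split U? P?) ⟩
    count U?                                 ≡⟨ cong length (filter-all U? {xs = allFin n} (All.tabulate (λ _ → tt))) ⟩
    length (allFin n)                        ≡⟨ length-tabulate (λ x → x) ⟩
    n                                        ∎
    where open ≡-Reasoning

  module _ (g : Fin n → Fin n) (g-involutive : ∀ x → g (g x) ≡ x) where

    private
      ascent? : Decidable (λ x → x < g x)
      ascent? x = x <? g x
      descent? : Decidable (λ x → g x < x)
      descent? x = g x <? x
      fixed? : Decidable (λ x → g x ≡ x)
      fixed? x = g x ≟ x

      g-injective : ∀ {x y} → g x ≡ g y → x ≡ y
      g-injective {x} {y} gx≡gy = trans (sym (g-involutive x)) (trans (cong g gx≡gy) (g-involutive y))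

    count-descent≡count-ascent : count descent? ≡ count ascent?
    count-descent≡count-ascent = ℕ.≤-antisym
      (count-injection descent? ascent? g (λ {x} gx<x → subst (g x <_) (sym (g-involutive x)) gx<x) (λ _ _ → g-injective))
      (count-injection ascent? descent? g (λ {x} x<gx → subst (_< g x) (sym (g-involutive x)) x<gx) (λ _ _ → g-injective))

    count-involution : count ascent? + count ascent? + count fixed? ≡ n
    count-involution = begin
      count ascent? + count ascent? + count fixed?   ≡⟨ ℕ.+-assoc (count ascent?) _ _ ⟩
      count ascent? + (count ascent? + count fixed?) ≡⟨ cong (count ascent? +_) (sym non-ascents) ⟩
      count ascent? + count (∁? ascent?)             ≡⟨ count-complement ascent? ⟩
      n                                              ∎
      where
      open ≡-Reasoning
      non-ascents : count (∁? ascent?) ≡ count ascent? + count fixed?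
      non-ascents = begin
        count (∁? ascent?)                                          ≡⟨ count-split (∁? ascent?) descent? ⟩
        count (∁? ascent? ∩? descent?) + count (∁? ascent? ∩? ∁? descent?)
          ≡⟨ cong₂ _+_ (trans (count-ext _ descent? proj₂ (λ gx<x → <-asym gx<x , gx<x)) count-descent≡count-ascent)
                       (count-ext _ fixed? (λ (¬a , ¬d) → neither ¬a ¬d) λ gx≡x → (λ x<gx → <-irrefl (sym gx≡x) x<gx) , λ gx<x → <-irrefl gx≡x gx<x) ⟩
        count ascent? + count fixed?                                ∎
        where
        neither : ∀ {x} → ¬ x < g x → ¬ g x < x → g x ≡ x
        neither {x} ¬a ¬d with <-cmp x (g x)
        ... | tri< a _ _ = ⊥-elim (¬a a)
        ... | tri≈ _ e _ = sym e
        ... | tri> _ _ d = ⊥-elim (¬d d)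

module FieldProperties {q : ℕ} (F : FiniteField q) where

  open FiniteField F

  commutativeRing : CommutativeRing 0ℓ 0ℓ
  commutativeRing = record { isCommutativeRing = isCommutativeRing }

  open CommutativeRing commutativeRing
    using (+-comm; +-identityˡ; -‿inverseʳ; -‿inverseˡ; *-assoc; *-comm;
           *-identityˡ; *-identityʳ; distribʳ; zeroʳ; ring; +-abelianGroup; +-commutativeSemigroup; *-commutativeSemigroup)
  open import Algebra.Properties.Ring ring using (-‿distribˡ-*; -‿distribʳ-*; x[y-z]≈xy-xz)
  open import Algebra.Properties.AbelianGroup +-abelianGroup
    using (⁻¹-involutive; x∙y⁻¹≈ε⇒x≈y; inverseˡ-unique)
  open import Algebra.Properties.CommutativeSemigroup *-commutativeSemigroup
    using () renaming (interchange to *-interchange)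
  open import Algebra.Properties.CommutativeSemigroup +-commutativeSemigroup
    using () renaming (interchange to +-interchange)
  open ≡-Reasoning

  -x*-y≡x*y : ∀ x y → (- x) * (- y) ≡ x * y
  -x*-y≡x*y x y = begin
    (- x) * (- y)   ≡⟨ -‿distribˡ-* x (- y) ⟨
    - (x * - y)     ≡⟨ cong -_ (-‿distribʳ-* x y) ⟨
    - (- (x * y))   ≡⟨ ⁻¹-involutive _ ⟩
    x * y           ∎

  inv : Fin q → Fin q
  inv x with x ≟ 0#
  ... | yes _  = 0#
  ... | no x≢0 = proj₁ (inverse x x≢0)

  *-inverseʳ : ∀ {x} → x ≢ 0# → x * inv x ≡ 1#
  *-inverseʳ {x} x≢0 with x ≟ 0#
  ... | yes x≡0 = ⊥-elim (x≢0 x≡0)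
  ... | no  x≢0 = proj₂ (inverse x x≢0)

  *-inverseˡ : ∀ {x} → x ≢ 0# → inv x * x ≡ 1#
  *-inverseˡ x≢0 = trans (*-comm _ _) (*-inverseʳ x≢0)

  *-cancelˡ : ∀ {z x y} → z ≢ 0# → z * x ≡ z * y → x ≡ y
  *-cancelˡ {z} {x} {y} z≢0 zx≡zy = begin
    x                ≡⟨ *-identityˡ x ⟨
    1# * x           ≡⟨ cong (_* x) (*-inverseˡ z≢0) ⟨
    (inv z * z) * x  ≡⟨ *-assoc _ _ _ ⟩
    inv z * (z * x)  ≡⟨ cong (inv z *_) zx≡zy ⟩
    inv z * (z * y)  ≡⟨ *-assoc _ _ _ ⟨
    (inv z * z) * y  ≡⟨ cong (_* y) (*-inverseˡ z≢0) ⟩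
    1# * y           ≡⟨ *-identityˡ y ⟩
    y                ∎

  x*y≡0⇒x≡0⊎y≡0 : ∀ {x y} → x * y ≡ 0# → x ≡ 0# ⊎ y ≡ 0#
  x*y≡0⇒x≡0⊎y≡0 {x} xy≡0 with x ≟ 0#
  ... | yes x≡0 = inj₁ x≡0
  ... | no  x≢0 = inj₂ (*-cancelˡ x≢0 (trans xy≡0 (sym (zeroʳ x))))

  x*y≢0 : ∀ {x y} → x ≢ 0# → y ≢ 0# → x * y ≢ 0#
  x*y≢0 x≢0 y≢0 xy≡0 with x*y≡0⇒x≡0⊎y≡0 xy≡0
  ... | inj₁ x≡0 = x≢0 x≡0
  ... | inj₂ y≡0 = y≢0 y≡0

  inv≢0 : ∀ {x} → x ≢ 0# → inv x ≢ 0#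
  inv≢0 {x} x≢0 inv≡0 = 0≢1 (begin
    0#          ≡⟨ zeroʳ x ⟨
    x * 0#      ≡⟨ cong (x *_) inv≡0 ⟨
    x * inv x   ≡⟨ *-inverseʳ x≢0 ⟩
    1#          ∎)

  inv-involutive : ∀ {x} → x ≢ 0# → inv (inv x) ≡ x
  inv-involutive x≢0 = *-cancelˡ (inv≢0 x≢0) (trans (*-inverseʳ (inv≢0 x≢0)) (sym (*-inverseˡ x≢0)))

  inv-injective : ∀ {x y} → x ≢ 0# → y ≢ 0# → inv x ≡ inv y → x ≡ y
  inv-injective x≢0 y≢0 invx≡invy = trans (sym (inv-involutive x≢0)) (trans (cong inv invx≡invy) (inv-involutive y≢0))

  x-x²/y≡[x-y][-x]/y : ∀ x {y} → y ≢ 0# → x + - (x * x * inv y) ≡ ((x + - y) * - x) * inv y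
  x-x²/y≡[x-y][-x]/y x {y} y≢0 = sym (begin
    ((x + - y) * - x) * inv y                ≡⟨ cong (_* inv y) (distribʳ _ _ _) ⟩
    (x * - x + (- y) * (- x)) * inv y        ≡⟨ cong₂ (λ u v → (u + v) * inv y) (-‿distribʳ-* x x) (sym (-x*-y≡x*y y x)) ⟨
    (- (x * x) + y * x) * inv y              ≡⟨ distribʳ _ _ _ ⟩
    - (x * x) * inv y + (y * x) * inv y      ≡⟨ cong₂ _+_ (sym (-‿distribˡ-* _ _)) yx/y≡x ⟩
    - (x * x * inv y) + x                    ≡⟨ +-comm _ _ ⟩
    x + - (x * x * inv y)                    ∎)
    where
    yx/y≡x : (y * x) * inv y ≡ x
    yx/y≡x = begin
      (y * x) * inv y  ≡⟨ cong (_* inv y) (*-comm y x) ⟩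
      (x * y) * inv y  ≡⟨ *-assoc _ _ _ ⟩
      x * (y * inv y)  ≡⟨ cong (x *_) (*-inverseʳ y≢0) ⟩
      x * 1#           ≡⟨ *-identityʳ x ⟩
      x                ∎

  x²≡y²⇒x≡±y : ∀ {x y} → x * x ≡ y * y → x ≡ y ⊎ x ≡ - y
  x²≡y²⇒x≡±y {x} {y} x²≡y² with x*y≡0⇒x≡0⊎y≡0 product≡0
    where
    product≡0 : (x + y) * (x + - y) ≡ 0#
    product≡0 = begin
      (x + y) * (x + - y)                       ≡⟨ distribʳ _ _ _ ⟩
      x * (x + - y) + y * (x + - y)             ≡⟨ cong₂ _+_ (x[y-z]≈xy-xz x x y) (x[y-z]≈xy-xz y x y) ⟩
      (x * x + - (x * y)) + (y * x + - (y * y)) ≡⟨ cong₂ (λ u v → (u + - (x * y)) + (v + - (y * y))) x²≡y² (*-comm y x) ⟩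
      (y * y + - (x * y)) + (x * y + - (y * y)) ≡⟨ cong ((y * y + - (x * y)) +_) (+-comm _ _) ⟩
      (y * y + - (x * y)) + (- (y * y) + x * y) ≡⟨ +-interchange _ _ _ _ ⟩
      (y * y + - (y * y)) + (- (x * y) + x * y) ≡⟨ cong₂ _+_ (-‿inverseʳ _) (-‿inverseˡ _) ⟩
      0# + 0#                                   ≡⟨ +-identityˡ 0# ⟩
      0#                                        ∎
  ... | inj₁ x+y≡0  = inj₂ (inverseˡ-unique x y x+y≡0)
  ... | inj₂ x-y≡0  = inj₁ (x∙y⁻¹≈ε⇒x≈y x y x-y≡0)

  Square NonSquare NonzeroSquare : Pred (Fin q) 0ℓ
  Square        = IsSquare F
  NonSquare     = ∁ Square
  NonzeroSquare = Square ∩ ∁ (_≡ 0#)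

  square? : Decidable Square
  square? x = any? (λ y → y * y ≟ x)

  nonSquare? : Decidable NonSquare
  nonSquare? = ∁? square?

  nonzeroSquare? : Decidable NonzeroSquare
  nonzeroSquare? = square? ∩? ∁? (_≟ 0#)

  0-square : Square 0#
  0-square = 0# , zeroʳ 0#

  square-* : ∀ {x y} → Square x → Square y → Square (x * y)
  square-* (r , refl) (s , refl) = r * s , *-interchange r s r s

  x²≢0 : ∀ {x} → x ≢ 0# → x * x ≢ 0#
  x²≢0 x≢0 = x*y≢0 x≢0 x≢0

  nonzeroSquare-* : ∀ {x y} → NonzeroSquare x → NonzeroSquare y → NonzeroSquare (x * y)
  nonzeroSquare-* (sx , x≢0) (sy , y≢0) = square-* sx sy , x*y≢0 x≢0 y≢0

  nonSquare≢0 : ∀ {x} → NonSquare x → x ≢ 0#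
  nonSquare≢0 ns refl = ns 0-square

  square-inv : ∀ {x} → NonzeroSquare x → Square (inv x)
  square-inv ((r , refl) , r²≢0) = r * inv (r * r) , (begin
    (r * inv (r * r)) * (r * inv (r * r))    ≡⟨ *-interchange r (inv (r * r)) r (inv (r * r)) ⟩
    (r * r) * (inv (r * r) * inv (r * r))    ≡⟨ *-assoc _ _ _ ⟨
    ((r * r) * inv (r * r)) * inv (r * r)    ≡⟨ cong (_* inv (r * r)) (*-inverseʳ r²≢0) ⟩
    1# * inv (r * r)                         ≡⟨ *-identityˡ _ ⟩
    inv (r * r)                              ∎)

  nonzeroSquare-inv : ∀ {x} → NonzeroSquare x → NonzeroSquare (inv x)
  nonzeroSquare-inv nzs = square-inv nzs , inv≢0 (proj₂ nzs)

  nonSquare-inv : ∀ {x} → NonSquare x → NonSquare (inv x)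
  nonSquare-inv {x} ns s = ns (subst Square (inv-involutive x≢0) (square-inv (s , inv≢0 x≢0)))
    where
    x≢0 : x ≢ 0#
    x≢0 = nonSquare≢0 ns

  nonzeroSquare-*-nonSquare : ∀ {s n} → NonzeroSquare s → NonSquare n → NonSquare (s * n)
  nonzeroSquare-*-nonSquare {s} {n} nzs ns sn-square = ns (subst Square cancel (square-* (square-inv nzs) sn-square))
    where
    cancel : inv s * (s * n) ≡ n
    cancel = trans (sym (*-assoc _ _ _)) (trans (cong (_* n) (*-inverseˡ (proj₂ nzs))) (*-identityˡ n))

Characteristic≢2 : ∀ {q} → FiniteField q → Set
Characteristic≢2 F = 1# + 1# ≢ 0#
  where open FiniteField F

odd-order⇒characteristic≢2 : ∀ {q} (F : FiniteField q) → (∀ m → q ≢ m +ℕ m) → Characteristic≢2 F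
odd-order⇒characteristic≢2 {q} F odd 1+1≡0 = odd (count ascent?) (begin
  q                                               ≡⟨ count-involution g g-involutive ⟨
  count ascent? +ℕ count ascent? +ℕ count fixed?  ≡⟨ cong (count ascent? +ℕ count ascent? +ℕ_) (count-none fixed? no-fixed-point) ⟩
  count ascent? +ℕ count ascent? +ℕ 0             ≡⟨ ℕ.+-identityʳ _ ⟩
  count ascent? +ℕ count ascent?                  ∎)
  where
  open FiniteField F using (1#; 0#; 0≢1) renaming (_+_ to _⊕_)
  open Counting q
  open CommutativeRing (FieldProperties.commutativeRing F) using (+-assoc; +-identityʳ; +-abelianGroup)
  open import Algebra.Properties.AbelianGroup +-abelianGroup using (∙-cancelˡ)
  open import Data.Fin using (_<_)
  open ≡-Reasoning
  g : Fin q → Fin q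
  g x = x ⊕ 1#
  g-involutive : ∀ x → g (g x) ≡ x
  g-involutive x = trans (+-assoc x 1# 1#) (trans (cong (x ⊕_) 1+1≡0) (+-identityʳ x))
  no-fixed-point : ∀ x → g x ≢ x
  no-fixed-point x x+1≡x = 0≢1 (sym (∙-cancelˡ x 1# 0# (trans x+1≡x (sym (+-identityʳ x)))))
  ascent? : Decidable (λ x → x < g x)
  ascent? x = x <? g x
  fixed? : Decidable (λ x → g x ≡ x)
  fixed? x = g x ≟ x

module OddFieldProperties {q : ℕ} (F : FiniteField q) (1+1≢0 : Characteristic≢2 F) where

  open FiniteField F
  open FieldProperties F
  open Counting q
  open import Data.Fin using (_<_)
  open CommutativeRing commutativeRing
    using (+-assoc; -‿inverseʳ; *-comm; *-identityˡ; distribʳ; zeroʳ; +-abelianGroup)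
  open import Algebra.Properties.AbelianGroup +-abelianGroup
    using (⁻¹-involutive; ⁻¹-injective; ∙-cancelˡ; ε⁻¹≈ε; xyx⁻¹≈y; ⁻¹-anti-homo‿-)

  x≡-x⇒x≡0 : ∀ {x} → x ≡ - x → x ≡ 0#
  x≡-x⇒x≡0 {x} x≡-x with x*y≡0⇒x≡0⊎y≡0 [1+1]x≡0
    where
    [1+1]x≡0 : (1# + 1#) * x ≡ 0#
    [1+1]x≡0 = trans (distribʳ x 1# 1#)
                 (trans (cong₂ _+_ (*-identityˡ x) (trans (*-identityˡ x) x≡-x)) (-‿inverseʳ x))
  ... | inj₁ 1+1≡0 = ⊥-elim (1+1≢0 1+1≡0)
  ... | inj₂ x≡0   = x≡0

  -- The order of Fin q picks one element out of each pair {x, -x} with x ≢ 0.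
  Upper : Pred (Fin q) 0ℓ
  Upper x = - x < x

  upper? : Decidable Upper
  upper? x = - x <? x

  upper⇒¬upper-neg : ∀ {x} → Upper x → ¬ Upper (- x)
  upper⇒¬upper-neg {x} -x<x upper-neg = <-asym -x<x (subst (_< - x) (⁻¹-involutive x) upper-neg)

  upper⇒x≢-x : ∀ {x} → Upper x → x ≢ - x
  upper⇒x≢-x -x<x x≡-x = <-irrefl (sym x≡-x) -x<x

  upper⇒x≢0 : ∀ {x} → Upper x → x ≢ 0#
  upper⇒x≢0 ux refl = upper⇒x≢-x ux (sym ε⁻¹≈ε)

  half : ℕ
  half = count upper?

  q≡1+2half : q ≡ suc (half +ℕ half)
  q≡1+2half = begin
    q                                ≡⟨ count-involution -_ ⁻¹-involutive ⟨
    lower +ℕ lower +ℕ count fixed?   ≡⟨ cong₂ (λ m k → m +ℕ m +ℕ k) (sym (count-descent≡count-ascent -_ ⁻¹-involutive)) fixed-unique ⟩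
    half +ℕ half +ℕ 1                ≡⟨ ℕ.+-comm _ 1 ⟩
    suc (half +ℕ half)               ∎
    where
    open ≡-Reasoning
    lower : ℕ
    lower = count (λ x → x <? - x)
    fixed? : Decidable (λ x → - x ≡ x)
    fixed? x = - x ≟ x
    fixed-unique : count fixed? ≡ 1
    fixed-unique = ℕ.≤-antisym
      (count≤1 fixed? (λ -x≡x -y≡y → trans (x≡-x⇒x≡0 (sym -x≡x)) (sym (x≡-x⇒x≡0 (sym -y≡y)))))
      (1≤count fixed? ε⁻¹≈ε)

  count-nonUpper : count (∁? upper?) ≡ suc half
  count-nonUpper = ℕ.+-cancelˡ-≡ half _ _ (begin
    half +ℕ count (∁? upper?)   ≡⟨ count-complement upper? ⟩
    q                           ≡⟨ q≡1+2half ⟩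
    suc (half +ℕ half)          ≡⟨ ℕ.+-suc half half ⟨
    half +ℕ suc half            ∎)
    where open ≡-Reasoning

  upper-root : ∀ {s} → NonzeroSquare s → ∃ λ r → Upper r × r * r ≡ s
  upper-root {s} ((r , r²≡s) , s≢0) with <-cmp r (- r)
  ... | tri< r<-r _ _ = - r , subst (_< - r) (sym (⁻¹-involutive r)) r<-r , trans (-x*-y≡x*y r r) r²≡s
  ... | tri≈ _ r≡-r _ = ⊥-elim (s≢0 (trans (sym r²≡s) (trans (cong (λ u → u * u) (x≡-x⇒x≡0 r≡-r)) (zeroʳ 0#))))
  ... | tri> _ _ -r<r = r , -r<r , r²≡s

  count-nonzeroSquare : count nonzeroSquare? ≡ half
  count-nonzeroSquare = ℕ.≤-antisym
    (count-surjection upper? nonzeroSquare? (λ r → r * r) upper-root)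
    (count-injection upper? nonzeroSquare? (λ r → r * r)
      (λ {r} ur → (r , refl) , x²≢0 (upper⇒x≢0 ur))
      squaring-injective)
    where
    squaring-injective : ∀ {x y} → Upper x → Upper y → x * x ≡ y * y → x ≡ y
    squaring-injective ux uy x²≡y² with x²≡y²⇒x≡±y x²≡y²
    ... | inj₁ x≡y  = x≡y
    ... | inj₂ refl = ⊥-elim (upper⇒¬upper-neg uy ux)

  count-square : count square? ≡ suc half
  count-square = begin
    count square?                                                   ≡⟨ count-split square? (_≟ 0#) ⟩
    count (square? ∩? (_≟ 0#)) +ℕ count nonzeroSquare?              ≡⟨ cong₂ _+ℕ_ zero-unique count-nonzeroSquare ⟩
    suc half                                                        ∎
    where
    open ≡-Reasoning
    zero-unique : count (square? ∩? (_≟ 0#)) ≡ 1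
    zero-unique = ℕ.≤-antisym (count≤1 _ (λ (_ , x≡0) (_ , y≡0) → trans x≡0 (sym y≡0))) (1≤count _ (0-square , refl))

  count-nonSquare : count nonSquare? ≡ half
  count-nonSquare = ℕ.+-cancelˡ-≡ (suc half) _ _ (begin
    suc half +ℕ count nonSquare?   ≡⟨ cong (_+ℕ count nonSquare?) count-square ⟨
    count square? +ℕ count nonSquare? ≡⟨ count-complement square? ⟩
    q                              ≡⟨ q≡1+2half ⟩
    suc (half +ℕ half)             ∎)
    where open ≡-Reasoning

  -- Otherwise t ↦ t a would map the half + 1 elements of NonzeroSquare ∪ {b} injectively into NonSquare.
  nonSquare-*-nonSquare : ∀ {a b} → NonSquare a → NonSquare b → Square (a * b)
  nonSquare-*-nonSquare {a} {b} nsa nsb with square? (a * b)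
  ... | yes ab-square = ab-square
  ... | no  ab-nonSquare = ⊥-elim (ℕ.<-irrefl refl (begin-strict
    half                                              ≡⟨ count-nonzeroSquare ⟨
    count nonzeroSquare?                              <⟨ ℕ.+-monoˡ-≤ _ (1≤count (_≟ b) refl) ⟩
    count (_≟ b) +ℕ count nonzeroSquare?              ≤⟨ count-disjoint (_≟ b) nonzeroSquare? P? inj₁ inj₂ (λ { refl (sb , _) → nsb sb }) ⟩
    count P?                                          ≤⟨ count-injection P? nonSquare? (_* a) maps-to (λ _ _ → *a-injective) ⟩
    count nonSquare?                                  ≡⟨ count-nonSquare ⟩
    half                                              ∎))
    where
    open ℕ.≤-Reasoning
    P? : Decidable (λ t → t ≡ b ⊎ NonzeroSquare t)
    P? = (_≟ b) ∪? nonzeroSquare?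
    maps-to : ∀ {t} → t ≡ b ⊎ NonzeroSquare t → NonSquare (t * a)
    maps-to (inj₁ refl) = subst NonSquare (*-comm a b) ab-nonSquare
    maps-to (inj₂ nzs)  = nonzeroSquare-*-nonSquare nzs nsa
    *a-injective : ∀ {x y} → x * a ≡ y * a → x ≡ y
    *a-injective xa≡ya = *-cancelˡ (nonSquare≢0 nsa) (trans (*-comm a _) (trans xa≡ya (*-comm _ a)))

  count-upper-± : {P : Pred (Fin q) 0ℓ} (P? : Decidable P) →
                  count (upper? ∩? (P? ∪? (λ x → P? (- x)))) ≤ count P?
  count-upper-± {P} P? = count-injection _ P? pick pick-P pick-injective
    where
    pick : Fin q → Fin q
    pick x with P? x
    ... | yes _ = x
    ... | no  _ = - x
    pick-P : ∀ {x} → Upper x × (P x ⊎ P (- x)) → P (pick x)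
    pick-P {x} (_ , px⊎p-x) with P? x | px⊎p-x
    ... | yes px  | _         = px
    ... | no  ¬px | inj₁ px   = ⊥-elim (¬px px)
    ... | no  _   | inj₂ p-x  = p-x
    pick-± : ∀ x → pick x ≡ x ⊎ pick x ≡ - x
    pick-± x with P? x
    ... | yes _ = inj₁ refl
    ... | no  _ = inj₂ refl
    pick-injective : ∀ {x y} → Upper x × _ → Upper y × _ → pick x ≡ pick y → x ≡ y
    pick-injective {x} {y} (ux , _) (uy , _) picks≡ with pick-± x | pick-± y
    ... | inj₁ px≡x | inj₁ py≡y = trans (sym px≡x) (trans picks≡ py≡y)
    ... | inj₁ px≡x | inj₂ py≡-y = ⊥-elim (upper⇒¬upper-neg uy (subst Upper (trans (sym px≡x) (trans picks≡ py≡-y)) ux))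
    ... | inj₂ px≡-x | inj₁ py≡y = ⊥-elim (upper⇒¬upper-neg ux (subst Upper (trans (sym py≡y) (trans (sym picks≡) px≡-x)) uy))
    ... | inj₂ px≡-x | inj₂ py≡-y = ⁻¹-injective (trans (sym px≡-x) (trans picks≡ py≡-y))

  Splits : Pred (Fin q) 0ℓ → Pred (Fin q) 0ℓ → Fin q → Pred (Fin q) 0ℓ
  Splits P Q c t = P t × Q (c + - t)

  splits? : {P Q : Pred (Fin q) 0ℓ} → Decidable P → Decidable Q → (c : Fin q) → Decidable (Splits P Q c)
  splits? P? Q? c t = P? t ×-dec Q? (c + - t)

  module _ {c : Fin q} (c≢0 : c ≢ 0#) where

    private
      φ : Fin q → Fin q
      φ t = c * c * inv t
      φ-injective : ∀ {t s} → t ≢ 0# → s ≢ 0# → φ t ≡ φ s → t ≡ s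
      φ-injective t≢0 s≢0 φt≡φs = inv-injective t≢0 s≢0 (*-cancelˡ (x²≢0 c≢0) φt≡φs)
      c²-nonzeroSquare : NonzeroSquare (c * c)
      c²-nonzeroSquare = (c , refl) , x²≢0 c≢0
      -c≢0 : - c ≢ 0#
      -c≢0 -c≡0 = c≢0 (⁻¹-injective (trans -c≡0 (sym ε⁻¹≈ε)))
      c-[c-t]≡t : ∀ t → c + - (c + - t) ≡ t
      c-[c-t]≡t t = trans (cong (c +_) (⁻¹-anti-homo‿- c t)) (trans (sym (+-assoc c t (- c))) (xyx⁻¹≈y c t))
      reflect : ∀ {t} → Splits NonSquare NonzeroSquare c t → Splits NonzeroSquare NonSquare c (c + - t)
      reflect {t} (nst , nzs) = nzs , subst NonSquare (sym (c-[c-t]≡t t)) nst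
      reflect-injective : ∀ {t s} → Splits NonSquare NonzeroSquare c t → Splits NonSquare NonzeroSquare c s →
                          c + - t ≡ c + - s → t ≡ s
      reflect-injective _ _ c-t≡c-s = ⁻¹-injective (∙-cancelˡ c _ _ c-t≡c-s)

      A : ℕ
      A = count (splits? nonSquare? nonzeroSquare? c)

      bound-if-neg-c-square : Square (- c) → A +ℕ A ≤ half
      bound-if-neg-c-square -c-square = begin
        A +ℕ A                                        ≤⟨ ℕ.+-monoʳ-≤ A (count-injection _ _ φ maps-to φ-injective′) ⟩
        A +ℕ count (splits? nonSquare? nonSquare? c)  ≤⟨ count-disjoint _ _ nonSquare? proj₁ proj₁ (λ (_ , nzs) (_ , ns) → ns (proj₁ nzs)) ⟩
        count nonSquare?                              ≡⟨ count-nonSquare ⟩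
        half                                          ∎
        where
        open ℕ.≤-Reasoning
        maps-to : ∀ {t} → Splits NonSquare NonzeroSquare c t → Splits NonSquare NonSquare c (φ t)
        maps-to (nst , nzs) = nonzeroSquare-*-nonSquare c²-nonzeroSquare (nonSquare-inv nst) ,
          subst NonSquare (sym (x-x²/y≡[x-y][-x]/y c (nonSquare≢0 nst)))
            (nonzeroSquare-*-nonSquare (nonzeroSquare-* nzs (-c-square , -c≢0)) (nonSquare-inv nst))
        φ-injective′ : ∀ {t s} → Splits NonSquare NonzeroSquare c t → Splits NonSquare NonzeroSquare c s → φ t ≡ φ s → t ≡ s
        φ-injective′ (nst , _) (nss , _) = φ-injective (nonSquare≢0 nst) (nonSquare≢0 nss)

      bound-if-neg-c-nonSquare : NonSquare (- c) → A +ℕ A ≤ half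
      bound-if-neg-c-nonSquare -c-nonSquare = begin
        A +ℕ A                                                  ≤⟨ ℕ.+-mono-≤ A≤A′ (ℕ.≤-trans A≤A′ (count-injection _ _ φ maps-to φ-injective′)) ⟩
        count (splits? nonzeroSquare? nonSquare? c) +ℕ count (splits? nonzeroSquare? nonzeroSquare? c)
                                                                ≤⟨ count-disjoint _ _ nonzeroSquare? proj₁ proj₁ (λ (_ , ns) (_ , nzs) → ns (proj₁ nzs)) ⟩
        count nonzeroSquare?                                    ≡⟨ count-nonzeroSquare ⟩
        half                                                    ∎
        where
        open ℕ.≤-Reasoning
        A≤A′ : A ≤ count (splits? nonzeroSquare? nonSquare? c)
        A≤A′ = count-injection _ _ (λ t → c + - t) reflect reflect-injective
        maps-to : ∀ {t} → Splits NonzeroSquare NonSquare c t → Splits NonzeroSquare NonzeroSquare c (φ t)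
        maps-to (nzs , ns) = nonzeroSquare-* c²-nonzeroSquare (nonzeroSquare-inv nzs) ,
          subst NonzeroSquare (sym (x-x²/y≡[x-y][-x]/y c (proj₂ nzs)))
            (nonzeroSquare-* (nonSquare-*-nonSquare ns -c-nonSquare , x*y≢0 (nonSquare≢0 ns) -c≢0) (nonzeroSquare-inv nzs))
        φ-injective′ : ∀ {t s} → Splits NonzeroSquare NonSquare c t → Splits NonzeroSquare NonSquare c s → φ t ≡ φ s → t ≡ s
        φ-injective′ (nzt , _) (nzs , _) = φ-injective (proj₂ nzt) (proj₂ nzs)

    -- The map t ↦ c²/t sends t and c - t to c²/t and (c - t)(-c)/t, so it moves splittings of c between
    -- square classes according to the class of -c.
    count-splits-nonSquare-nonzeroSquare :
      count (splits? nonSquare? nonzeroSquare? c) +ℕ count (splits? nonSquare? nonzeroSquare? c) ≤ half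
    count-splits-nonSquare-nonzeroSquare with square? (- c)
    ... | yes -c-square    = bound-if-neg-c-square -c-square
    ... | no  -c-nonSquare = bound-if-neg-c-nonSquare -c-nonSquare

module _ {A : Set} where

  record Interior (vs : List A) (x : A) : Set where
    constructor interior
    field
      prev next     : A
      before after  : List A
      decomposition : vs ≡ before ++ prev ∷ x ∷ next ∷ after

  position : ∀ {x} vs → x ∈ vs → head vs ≡ just x ⊎ last vs ≡ just x ⊎ Interior vs x
  position (_ ∷ _)     (here refl) = inj₁ refl
  position (y ∷ z ∷ r) (there x∈)  with position (z ∷ r) x∈
  ... | inj₂ (inj₁ last≡x) = inj₂ (inj₁ last≡x)
  ... | inj₂ (inj₂ (interior p s xs zs eq)) = inj₂ (inj₂ (interior p s (y ∷ xs) zs (cong (y ∷_) eq)))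
  position (y ∷ z ∷ [])    (there x∈) | inj₁ refl = inj₂ (inj₁ refl)
  position (y ∷ z ∷ t ∷ r) (there x∈) | inj₁ refl = inj₂ (inj₂ (interior y t [] r refl))

module Consecutive {q : ℕ} (F : FiniteField q) {A : Set} where

  interior⇒∈-consecutive : ∀ {vs : List A} {x} (I : Interior vs x) →
                           (Interior.prev I , x) ∈ consecutive F vs × (x , Interior.next I) ∈ consecutive F vs
  interior⇒∈-consecutive (interior _ _ before after refl) = go before
    where
    go : ∀ (xs : List A) {p x s} → (p , x) ∈ consecutive F (xs ++ p ∷ x ∷ s ∷ after) ×
                                   (x , s) ∈ consecutive F (xs ++ p ∷ x ∷ s ∷ after)
    go []           = here refl , there (here refl)
    go (_ ∷ [])     = there (here refl) , there (there (here refl))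
    go (_ ∷ z ∷ xs) = Product.map there there (go (z ∷ xs))

  consecutive⇒∈ : ∀ {p x} (vs : List A) → (p , x) ∈ consecutive F vs → p ∈ vs
  consecutive⇒∈ (_ ∷ _ ∷ _) (here refl) = here refl
  consecutive⇒∈ (_ ∷ y ∷ r) (there p∈) = there (consecutive⇒∈ (y ∷ r) p∈)

  consecutive-functional : ∀ {p x y} (vs : List A) → Unique vs →
                           (p , x) ∈ consecutive F vs → (p , y) ∈ consecutive F vs → x ≡ y
  consecutive-functional (_ ∷ _ ∷ _) _            (here refl) (here refl) = refl
  consecutive-functional (_ ∷ z ∷ r) (p∉ ∷ _)    (here refl) (there p∈)  = ⊥-elim (All.lookup p∉ (consecutive⇒∈ (z ∷ r) p∈) refl)
  consecutive-functional (_ ∷ z ∷ r) (p∉ ∷ _)    (there p∈)  (here refl) = ⊥-elim (All.lookup p∉ (consecutive⇒∈ (z ∷ r) p∈) refl)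
  consecutive-functional (_ ∷ z ∷ r) (_ ∷ u)     (there p∈)  (there p∈′) = consecutive-functional (z ∷ r) u p∈ p∈′

bound-arithmetic : ∀ {n h m} → n ≤ suc m +ℕ 2 +ℕ suc h → m +ℕ m ≤ h → 4 *ℕ n ≤ 3 *ℕ suc (h +ℕ h) +ℕ 13
bound-arithmetic {n} {h} {m} n≤ m+m≤h = begin
  4 *ℕ n                               ≤⟨ ℕ.*-monoʳ-≤ 4 n≤ ⟩
  4 *ℕ (suc m +ℕ 2 +ℕ suc h)           ≡⟨ expand m h ⟩
  2 *ℕ (m +ℕ m) +ℕ (4 *ℕ h +ℕ 16)      ≤⟨ ℕ.+-monoˡ-≤ _ (ℕ.*-monoʳ-≤ 2 m+m≤h) ⟩
  2 *ℕ h +ℕ (4 *ℕ h +ℕ 16)             ≡⟨ collect h ⟩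
  3 *ℕ suc (h +ℕ h) +ℕ 13              ∎
  where
  open ℕ.≤-Reasoning
  expand : ∀ m h → 4 *ℕ (suc m +ℕ 2 +ℕ suc h) ≡ 2 *ℕ (m +ℕ m) +ℕ (4 *ℕ h +ℕ 16)
  expand = solve-∀
  collect : ∀ h → 2 *ℕ h +ℕ (4 *ℕ h +ℕ 16) ≡ 3 *ℕ suc (h +ℕ h) +ℕ 13
  collect = solve-∀

module AlternatingPaths
  {q : ℕ} (F : FiniteField q) (1+1≢0 : Characteristic≢2 F)
  (λ' : Fin q) (λ-nonSquare : ¬ IsSquare F λ')
  (w : List (Fin q)) (a : Fin q) (a≢0 : a ≢ FiniteField.0# F)
  (f-injective : ∀ {x y} → fPoly F w a x ≡ fPoly F w a y → x ≡ y)
  where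

  open FiniteField F
  open FieldProperties F
  open OddFieldProperties F 1+1≢0
  open Counting q
  open Consecutive F
  open import Data.List.Membership.DecPropositional (_≟_ {q}) using (_∈?_)
  open CommutativeRing commutativeRing
    using (*-comm; *-identityˡ; +-identityˡ; -‿inverseˡ; distribʳ; zeroˡ; zeroʳ; +-abelianGroup; +-commutativeSemigroup)
  open import Algebra.Properties.AbelianGroup +-abelianGroup using (⁻¹-involutive; ⁻¹-injective; x∙y⁻¹≈ε⇒x≈y; x≈z//y)
  open import Algebra.Properties.CommutativeSemigroup +-commutativeSemigroup
    using () renaming (interchange to +-interchange)

  f : Fin q → Fin q
  f = fPoly F w a

  open Graph F λ' f

  c : Fin q
  c = a + a

  c≢0 : c ≢ 0#
  c≢0 = subst (_≢ 0#) [1+1]a≡a+a (x*y≢0 1+1≢0 a≢0)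
    where
    [1+1]a≡a+a : (1# + 1#) * a ≡ a + a
    [1+1]a≡a+a = trans (distribʳ a 1# 1#) (cong₂ _+_ (*-identityˡ a) (*-identityˡ a))

  f-neg : ∀ x → f (- x) ≡ c + - f x
  f-neg x = x≈z//y (f (- x)) (f x) c (begin
    (- x) * evalPoly F w ((- x) * (- x)) + a + (x * E + a)  ≡⟨ cong (λ y → (- x) * evalPoly F w y + a + (x * E + a)) (-x*-y≡x*y x x) ⟩
    ((- x) * E + a) + (x * E + a)                            ≡⟨ +-interchange _ _ _ _ ⟩
    ((- x) * E + x * E) + c                                  ≡⟨ cong (_+ c) (sym (distribʳ E (- x) x)) ⟩
    (- x + x) * E + c                                        ≡⟨ cong (λ y → y * E + c) (-‿inverseˡ x) ⟩
    0# * E + c                                               ≡⟨ cong (_+ c) (zeroˡ E) ⟩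
    0# + c                                                   ≡⟨ +-identityˡ c ⟩
    c                                                        ∎)
    where
    open ≡-Reasoning
    E : Fin q
    E = evalPoly F w (x * x)

  target : Bool → Fin q → Fin q
  target true  y = y * y
  target false y = λ' * (y * y)

  target-neg : ∀ b y → target b (- y) ≡ target b y
  target-neg true  y = -x*-y≡x*y y y
  target-neg false y = cong (λ' *_) (-x*-y≡x*y y y)

  edge⇒λy²≡f : ∀ {x y} → Edge x y → y * y ≢ f x → λ' * (y * y) ≡ f x
  edge⇒λy²≡f edge y²≢fx with x*y≡0⇒x≡0⊎y≡0 edge
  ... | inj₁ y²-fx≡0  = ⊥-elim (y²≢fx (x∙y⁻¹≈ε⇒x≈y _ _ y²-fx≡0))
  ... | inj₂ λy²-fx≡0 = x∙y⁻¹≈ε⇒x≈y _ _ λy²-fx≡0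

  edge⇒target≡f : ∀ {x y} → Edge x y → target (weight x y) y ≡ f x
  edge⇒target≡f {x} {y} edge with y * y ≟ f x
  ... | yes y²≡fx = y²≡fx
  ... | no  y²≢fx = edge⇒λy²≡f edge y²≢fx

  SquareClass : Bool → Pred (Fin q) 0ℓ
  SquareClass true  = Square
  SquareClass false = NonSquare

  edge⇒squareClass : ∀ {x y} → Edge x y → SquareClass (weight x y) (f x)
  edge⇒squareClass {x} {y} edge with y * y ≟ f x
  ... | yes y²≡fx = y , y²≡fx
  ... | no  y²≢fx = subst NonSquare (trans (*-comm _ _) λy²≡fx)
                      (nonzeroSquare-*-nonSquare ((y , refl) , y²≢0) λ-nonSquare)
    where
    λy²≡fx : λ' * (y * y) ≡ f x
    λy²≡fx = edge⇒λy²≡f edge y²≢fx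
    y²≢0 : y * y ≢ 0#
    y²≢0 y²≡0 = y²≢fx (trans y²≡0 (sym (trans (sym λy²≡fx) (trans (cong (λ' *_) y²≡0) (zeroʳ λ')))))

  Mixed : Pred (Fin q) 0ℓ
  Mixed y = NonSquare (f y) × Square (f (- y))

  mixed? : Decidable Mixed
  mixed? y = nonSquare? (f y) ×-dec square? (f (- y))

  module _ {vs : List (Fin q)} (path : IsPath vs) (no-trail : ¬ ContainsTrail 2 vs) where

    open Interior

    private
      in-edge : ∀ {x} (I : Interior vs x) → Edge (prev I) x
      in-edge I = All.lookup (proj₂ path) (proj₁ (interior⇒∈-consecutive I))

      out-edge : ∀ {x} (I : Interior vs x) → Edge x (next I)
      out-edge I = All.lookup (proj₂ path) (proj₂ (interior⇒∈-consecutive I))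

    interior-alternates : ∀ {x} (I : Interior vs x) → weight (prev I) x ≢ weight x (next I)
    interior-alternates {x} I w≡ = no-trail
      (before I , prev I ∷ x ∷ next I ∷ [] , after I , decomposition I , refl , _ , refl ∷ sym w≡ ∷ [])

    interior-±⇒mixed : ∀ {x} → Interior vs x → Interior vs (- x) → x ≢ - x → Mixed x ⊎ Mixed (- x)
    interior-±⇒mixed {x} I J x≢-x =
      classes (edge⇒squareClass (out-edge I)) (edge⇒squareClass (out-edge J)) out-weights-differ
      where
      in-weights-differ : weight (prev I) x ≢ weight (prev J) (- x)
      in-weights-differ w≡ = x≢-x (consecutive-functional vs (proj₁ path)
        (proj₁ (interior⇒∈-consecutive I))
        (subst (λ p → (p , - x) ∈ consecutive F vs) (sym same-prev) (proj₁ (interior⇒∈-consecutive J))))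
        where
        same-prev : prev I ≡ prev J
        same-prev = f-injective (begin
          f (prev I)                           ≡⟨ edge⇒target≡f (in-edge I) ⟨
          target (weight (prev I) x) x         ≡⟨ cong (λ b → target b x) w≡ ⟩
          target (weight (prev J) (- x)) x     ≡⟨ target-neg (weight (prev J) (- x)) x ⟨
          target (weight (prev J) (- x)) (- x) ≡⟨ edge⇒target≡f (in-edge J) ⟩
          f (prev J)                           ∎)
          where open ≡-Reasoning
      out-weights-differ : weight x (next I) ≢ weight (- x) (next J)
      out-weights-differ w≡ = in-weights-differ (trans (¬-not (interior-alternates I))
                                               (trans (cong not w≡) (sym (¬-not (interior-alternates J)))))
      classes : ∀ {b b′} → SquareClass b (f x) → SquareClass b′ (f (- x)) → b ≢ b′ → Mixed x ⊎ Mixed (- x)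
      classes {true}  {true}  _   _    b≢b′ = ⊥-elim (b≢b′ refl)
      classes {false} {false} _   _    b≢b′ = ⊥-elim (b≢b′ refl)
      classes {false} {true}  nsx s-x  _    = inj₁ (nsx , s-x)
      classes {true}  {false} sx  ns-x _    = inj₂ (ns-x , subst (λ y → Square (f y)) (sym (⁻¹-involutive x)) sx)

    private
      inPath? : Decidable (_∈ vs)
      inPath? x = x ∈? vs

      negInPath? : Decidable (λ x → - x ∈ vs)
      negInPath? x = - x ∈? vs

      isHead? : Decidable (λ x → head vs ≡ just x)
      isHead? x = Maybe.≡-dec _≟_ (head vs) (just x)

      isLast? : Decidable (λ x → last vs ≡ just x)
      isLast? x = Maybe.≡-dec _≟_ (last vs) (just x)

      A : ℕ
      A = count (splits? nonSquare? nonzeroSquare? c)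

    count-mixed : count mixed? ≤ suc A
    count-mixed = begin
      count mixed?                                  ≤⟨ count-injection mixed? (splits? nonSquare? square? c) f
                                                         (λ {y} (ns , s) → ns , subst Square (f-neg y) s) (λ _ _ → f-injective) ⟩
      count (splits? nonSquare? square? c)          ≤⟨ count-mono _ (zero? ∪? splits? nonSquare? nonzeroSquare? c) zero-or-nonzero ⟩
      count (zero? ∪? splits? nonSquare? nonzeroSquare? c)
                                                    ≤⟨ count-∪ zero? _ ⟩
      count zero? +ℕ A                              ≤⟨ ℕ.+-monoˡ-≤ A (count≤1 zero? λ c-t≡0 c-s≡0 →
                                                         trans (sym (x∙y⁻¹≈ε⇒x≈y _ _ c-t≡0)) (x∙y⁻¹≈ε⇒x≈y _ _ c-s≡0)) ⟩
      suc A                                         ∎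
      where
      open ℕ.≤-Reasoning
      zero? : Decidable (λ t → c + - t ≡ 0#)
      zero? t = c + - t ≟ 0#
      zero-or-nonzero : ∀ {t} → Splits NonSquare Square c t → c + - t ≡ 0# ⊎ Splits NonSquare NonzeroSquare c t
      zero-or-nonzero {t} (ns , s) with c + - t ≟ 0#
      ... | yes c-t≡0 = inj₁ c-t≡0
      ... | no  c-t≢0 = inj₂ (ns , s , c-t≢0)

    count-paired : count ((inPath? ∩? upper?) ∩? negInPath?) ≤ suc A +ℕ 2
    count-paired = begin
      count ((inPath? ∩? upper?) ∩? negInPath?)       ≤⟨ count-mono _ (mixed-pairs ∪? (head-pairs ∪? last-pairs)) paired-cases ⟩
      count (mixed-pairs ∪? (head-pairs ∪? last-pairs))
                                                    ≤⟨ count-∪ mixed-pairs _ ⟩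
      count mixed-pairs +ℕ count (head-pairs ∪? last-pairs)
                                                    ≤⟨ ℕ.+-monoʳ-≤ (count mixed-pairs) (count-∪ head-pairs last-pairs) ⟩
      count mixed-pairs +ℕ (count head-pairs +ℕ count last-pairs)
                                                    ≤⟨ ℕ.+-mono-≤ (ℕ.≤-trans (count-upper-± mixed?) count-mixed)
                                                         (ℕ.+-mono-≤ (ℕ.≤-trans (count-upper-± isHead?) (count≤1 isHead? just-unique))
                                                                     (ℕ.≤-trans (count-upper-± isLast?) (count≤1 isLast? just-unique))) ⟩
      suc A +ℕ 2                                    ∎
      where
      open ℕ.≤-Reasoning
      mixed-pairs : Decidable (Upper ∩ (Mixed ∪ λ x → Mixed (- x)))
      mixed-pairs = upper? ∩? (mixed? ∪? λ x → mixed? (- x))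
      head-pairs : Decidable (Upper ∩ ((λ x → head vs ≡ just x) ∪ λ x → head vs ≡ just (- x)))
      head-pairs = upper? ∩? (isHead? ∪? λ x → isHead? (- x))
      last-pairs : Decidable (Upper ∩ ((λ x → last vs ≡ just x) ∪ λ x → last vs ≡ just (- x)))
      last-pairs = upper? ∩? (isLast? ∪? λ x → isLast? (- x))
      just-unique : ∀ {m : Maybe (Fin q)} {x y} → m ≡ just x → m ≡ just y → x ≡ y
      just-unique m≡x m≡y = Maybe.just-injective (trans (sym m≡x) m≡y)
      paired-cases : ∀ {x} → (x ∈ vs × Upper x) × - x ∈ vs →
                     Upper x × (Mixed x ⊎ Mixed (- x)) ⊎
                     Upper x × (head vs ≡ just x ⊎ head vs ≡ just (- x)) ⊎ Upper x × (last vs ≡ just x ⊎ last vs ≡ just (- x))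
      paired-cases {x} ((x∈ , ux) , -x∈) with position vs x∈ | position vs -x∈
      ... | inj₁ hx              | _                    = inj₂ (inj₁ (ux , inj₁ hx))
      ... | _                    | inj₁ h-x             = inj₂ (inj₁ (ux , inj₂ h-x))
      ... | inj₂ (inj₁ lx)       | _                    = inj₂ (inj₂ (ux , inj₁ lx))
      ... | _                    | inj₂ (inj₁ l-x)      = inj₂ (inj₂ (ux , inj₂ l-x))
      ... | inj₂ (inj₂ I)        | inj₂ (inj₂ J)        = inj₁ (ux , interior-±⇒mixed I J (upper⇒x≢-x ux))

    count-unpaired : count (inPath? ∩? ∁? upper?) +ℕ count ((inPath? ∩? upper?) ∩? ∁? negInPath?) ≤ suc half
    count-unpaired = begin
      count (inPath? ∩? ∁? upper?) +ℕ count ((inPath? ∩? upper?) ∩? ∁? negInPath?)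
        ≤⟨ ℕ.+-monoʳ-≤ _ (count-injection _ (∁? upper? ∩? ∁? inPath?) -_
             (λ ((_ , ux) , -x∉) → upper⇒¬upper-neg ux , -x∉) (λ _ _ → ⁻¹-injective)) ⟩
      count (inPath? ∩? ∁? upper?) +ℕ count (∁? upper? ∩? ∁? inPath?)
        ≤⟨ count-disjoint _ _ (∁? upper?) proj₂ proj₁ (λ (x∈ , _) (_ , x∉) → x∉ x∈) ⟩
      count (∁? upper?)
        ≡⟨ count-nonUpper ⟩
      suc half ∎
      where open ℕ.≤-Reasoning

    length-bound : 4 *ℕ length vs ≤ 3 *ℕ q +ℕ 13
    length-bound = subst (λ n → 4 *ℕ length vs ≤ 3 *ℕ n +ℕ 13) (sym q≡1+2half)
      (bound-arithmetic (begin
        length vs                                   ≤⟨ length≤count inPath? vs (proj₁ path) (λ x∈ → x∈) ⟩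
        count inPath?                               ≡⟨ count-split inPath? upper? ⟩
        count (inPath? ∩? upper?) +ℕ count (inPath? ∩? ∁? upper?)
                                                    ≡⟨ cong (_+ℕ count (inPath? ∩? ∁? upper?)) (count-split (inPath? ∩? upper?) negInPath?) ⟩
        paired +ℕ unpaired₂ +ℕ unpaired₁            ≡⟨ ℕ.+-assoc paired unpaired₂ unpaired₁ ⟩
        paired +ℕ (unpaired₂ +ℕ unpaired₁)          ≡⟨ cong (paired +ℕ_) (ℕ.+-comm unpaired₂ unpaired₁) ⟩
        paired +ℕ (unpaired₁ +ℕ unpaired₂)          ≤⟨ ℕ.+-mono-≤ count-paired count-unpaired ⟩
        suc A +ℕ 2 +ℕ suc half                      ∎)
      (count-splits-nonSquare-nonzeroSquare c≢0))
      where
      open ℕ.≤-Reasoning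
      paired unpaired₁ unpaired₂ : ℕ
      paired    = count ((inPath? ∩? upper?) ∩? negInPath?)
      unpaired₁ = count (inPath? ∩? ∁? upper?)
      unpaired₂ = count ((inPath? ∩? upper?) ∩? ∁? negInPath?)

open import Data.Nat using (_+_; _*_; _<_)

prime∣m^n⇒prime∣m : ∀ {p} m n → Prime p → p ∣ m ^ n → p ∣ m
prime∣m^n⇒prime∣m m zero    p-prime p∣1 = ⊥-elim (¬prime[1] (subst Prime (∣1⇒≡1 p∣1) p-prime))
prime∣m^n⇒prime∣m m (suc n) p-prime p∣m^[1+n] with euclidsLemma m (m ^ n) p-prime p∣m^[1+n]
... | inj₁ p∣m   = p∣m
... | inj₂ p∣m^n = prime∣m^n⇒prime∣m m n p-prime p∣m^n

odd-prime^n≢m+m : ∀ {p} n → Prime p → p ≢ 2 → ∀ m → p ^ n ≢ m + m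
odd-prime^n≢m+m {p} n p-prime p≢2 m p^n≡m+m
  with prime⇒irreducible p-prime (prime∣m^n⇒prime∣m p n prime[2] 2∣p^n)
  where
  2∣p^n : 2 ∣ p ^ n
  2∣p^n = subst (2 ∣_) (trans (cong (m +_) (ℕ.+-identityʳ m)) (sym p^n≡m+m)) (m∣m*n m)
... | inj₁ ()
... | inj₂ 2≡p = p≢2 (sym 2≡p)

n≤[3q+17]/4 : ∀ {n q} → 4 * n ≤ 3 * q + 13 → n ≤ (3 * q + 17) / 4
n≤[3q+17]/4 {n} {q} 4n≤ = begin
  n                   ≡⟨ m*n/n≡m n 4 ⟨
  n * 4 / 4           ≤⟨ /-monoˡ-≤ 4 (ℕ.≤-trans (ℕ.≤-reflexive (ℕ.*-comm n 4)) (ℕ.≤-trans 4n≤ (ℕ.+-monoʳ-≤ (3 * q) (ℕ.m≤m+n 13 4)))) ⟩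
  (3 * q + 17) / 4    ∎
  where open ℕ.≤-Reasoning

q≤1+n⇒q≤17 : ∀ {n q} → q ≤ suc n → 4 * n ≤ 3 * q + 13 → q ≤ 17
q≤1+n⇒q≤17 {n} {q} q≤1+n 4n≤ = ℕ.+-cancelˡ-≤ (3 * q) q 17 (begin
  3 * q + q          ≡⟨ four-q q ⟩
  4 * q              ≤⟨ ℕ.*-monoʳ-≤ 4 q≤1+n ⟩
  4 * suc n          ≡⟨ four-suc n ⟩
  4 * n + 4          ≤⟨ ℕ.+-monoˡ-≤ 4 4n≤ ⟩
  3 * q + 13 + 4     ≡⟨ ℕ.+-assoc (3 * q) 13 4 ⟩
  3 * q + 17         ∎)
  where
  open ℕ.≤-Reasoning
  four-q : ∀ q → 3 * q + q ≡ 4 * q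
  four-q = solve-∀
  four-suc : ∀ n → 4 * suc n ≡ 4 * n + 4
  four-suc = solve-∀

theorem2p11 : (q p k : ℕ) → Prime p → p ≢ 2 → q ≡ p ^ suc k →
    (F : FiniteField q) →
    (λ' : Fin q) → ¬ IsSquare F λ' →
    (w : List (Fin q)) → (a : Fin q) → a ≢ FiniteField.0# F →
    IsPermutation F (fPoly F w a) →
    ((vs : List (Fin q)) → Graph.IsTypePath F λ' (fPoly F w a) 1 vs →
       length vs ≤ (3 * q + 17) / 4)
    ×
    (17 < q → Graph.Connected F λ' (fPoly F w a) →
       (rest : List (Fin q)) → ¬ Graph.IsTypeHamCycle F λ' (fPoly F w a) 1 rest)
theorem2p11 q p k p-prime p≢2 q≡p^[1+k] F λ' λ-nonSquare w a a≢0 (f-injective , _) =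
  (λ vs type-1 → n≤[3q+17]/4 {q = q} (bound type-1)) ,
  (λ 17<q _ rest (hamiltonian , type-1) →
     ℕ.<⇒≱ 17<q (q≤1+n⇒q≤17 (n≤length (FiniteField.0# F ∷ rest) (proj₁ (proj₂ hamiltonian))) (bound type-1)))
  where
  q-odd : ∀ m → q ≢ m + m
  q-odd m q≡m+m = odd-prime^n≢m+m (suc k) p-prime p≢2 m (trans (sym q≡p^[1+k]) q≡m+m)
  open Counting q using (n≤length)
  open AlternatingPaths F (odd-order⇒characteristic≢2 F q-odd) λ' λ-nonSquare w a a≢0 f-injective
  bound : ∀ {vs} → Graph.IsTypePath F λ' (fPoly F w a) 1 vs → 4 * length vs ≤ 3 * q + 13
  bound (path , _ , maximal) = length-bound path (maximal 2 (s≤s (s≤s z≤n)))
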